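{- Let $H$ be a fixed graph on $k$ vertices and let $\mathcal{P}_H$ denote the property of containing $H$ as a subgraph. Then, as $n\to\infty$, \[ \mathrm{min\text{ - }cost}_n(\mathcal{P}_H) = \Omega(n^{1/k}). \]
   Context: Node-query setting: a graph $G=(V,E)$ on $n$ vertices and a graph property $\mathcal{P}$ are fixed. An unknown subset $S \subseteq V$ is accessible only via queries "Does $i \in S$?". $\mathrm{cost}(\mathcal{P},G)$ is the deterministic query complexity (worst-case number of queries of an optimal decision tree) of deciding whether the induced subgraph $G[S]$ satisfies $\mathcal{P}$. A vertex $i$ of $G$ is relevant for $\mathcal{P}$ if there is some $S \ni i$ such that exactly one of $G[S]$ and $G[S\setminus\{i\}]$ satisfies $\mathcal{P}$; $G$ is relevant for $\mathcal{P}$ if all its vertices are relevant. $\mathrm{min\text{ - }cost}_n(\mathcal{P}) = \min\{\mathrm{cost}(\mathcal{P},G) : G \text{ relevant for } \mathcal{P},\ |V(G)|=n\}$. -}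

module Defs where

open import Data.Nat using (ℕ; _≤_; _*_; _^_; suc; _⊔_)
open import Data.Bool using (Bool; true; false; if_then_else_)
open import Data.Fin using (Fin; _≟_)
open import Data.Product using (Σ; _×_; ∃-syntax)
open import Data.Sum using (_⊎_)
open import Relation.Nullary using (¬_; does)
open import Relation.Binary.PropositionalEquality using (_≡_)
open import Function.Bundles using (_⇔_)
open import Function.Definitions using (Injective)

record Graph (n : ℕ) : Set where
  field
    adj   : Fin n → Fin n → Bool
    sym   : ∀ u v → adj u v ≡ adj v u
    irrefl : ∀ v → adj v v ≡ false
open Graph public

VSet : ℕ → Set
VSet n = Fin n → Bool

remove : ∀ {n} → VSet n → Fin n → VSet n
remove S i j = if does (j ≟ i) then false else S j

-- The induced subgraph G[S] contains H as a (not necessarily induced)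
-- subgraph: an injective map of V(H) into S preserving edges of H.
ContainsIn : ∀ {k n} → Graph k → Graph n → VSet n → Set
ContainsIn {k} {n} H G S =
  Σ (Fin k → Fin n) λ φ →
    Injective _≡_ _≡_ φ ×
    (∀ v → S (φ v) ≡ true) ×
    (∀ u v → adj H u v ≡ true → adj G (φ u) (φ v) ≡ true)

data DTree (n : ℕ) : Set where
  leaf  : Bool → DTree n
  query : Fin n → (ifOut ifIn : DTree n) → DTree n

eval : ∀ {n} → DTree n → VSet n → Bool
eval (leaf b) S = b
eval (query i t₀ t₁) S = if S i then eval t₁ S else eval t₀ S

depth : ∀ {n} → DTree n → ℕ
depth (leaf _) = 0
depth (query _ t₀ t₁) = suc (depth t₀ ⊔ depth t₁)

Decides : ∀ {n} → DTree n → (VSet n → Set) → Set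
Decides {n} T P = ∀ (S : VSet n) → (eval T S ≡ true) ⇔ P S

RelevantVertex : ∀ {n} → (VSet n → Set) → Fin n → Set
RelevantVertex {n} P i =
  Σ (VSet n) λ S → S i ≡ true ×
    ((P S × ¬ P (remove S i)) ⊎ (¬ P S × P (remove S i)))

RelevantGraph : ∀ {k n} → Graph k → Graph n → Set
RelevantGraph H G = ∀ i → RelevantVertex (ContainsIn H G) i

-- Every vertex of a relevant G lies in a copy of H, i.e. in a set W of k vertices that
-- T accepts while rejecting each W ∖ {i}.  Such a minimal certificate of size m must meet
-- the path T follows on the empty set (else T treats W and W ∖ {v} alike); fixing a hit
-- vertex q to "in" leaves a minimal certificate W ∖ {q} of size m − 1 for a tree of no
-- larger depth.  Hence all of V lies in an explicit list of at most k · depth(T)^k vertices.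
module Submission where

open import Defs hiding (sym)
open import Data.Nat using (ℕ; zero; suc; _+_; _*_; _^_; _≤_; z≤n; s≤s)
open import Data.Nat.Properties
  using (≤-refl; ≤-trans; m≤m⊔n; m≤n⊔m; ⊔-mono-≤; n≤1+n; +-mono-≤; *-mono-≤;
         m≤m*n; m^n≢0; <-irrefl; *-commutativeSemigroup; module ≤-Reasoning)
open import Algebra.Properties.CommutativeSemigroup *-commutativeSemigroup using (x∙yz≈y∙xz)
open import Data.Bool using (true; false)
open import Data.Bool.Properties using () renaming (_≟_ to _≟ᵇ_)
open import Data.Fin using (Fin; punchIn; punchOut; _≟_)
open import Data.Fin.Properties using (punchIn-punchOut; injective⇒≤; any?)
open import Data.List using (List; []; _∷_; _++_; length; lookup; concatMap)
open import Data.List.Properties using (length-++)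
open import Data.List.Membership.Propositional using (_∈_; find; lose)
open import Data.List.Membership.Propositional.Properties using (∈-++⁺ˡ; ∈-++⁺ʳ; ∈-concatMap⁺)
open import Data.List.Relation.Unary.Any using (Any; here; there; index)
open import Data.List.Relation.Unary.Any.Properties using (lookup-index)
import Data.List.Relation.Unary.Any as Any
open import Data.Product using (Σ; ∃; _×_; _,_; proj₁; proj₂)
open import Data.Sum using (inj₁; inj₂)
open import Data.Empty using (⊥-elim)
open import Relation.Nullary using (¬_; yes; no; does; contradiction)
open import Relation.Binary.PropositionalEquality using (_≡_; _≢_; refl; sym; trans; cong)
open import Function using (_∘_)
open import Function.Bundles using (Equivalence)

module _ {n : ℕ} where

  remove≡true⁻ : (X : VSet n) (i j : Fin n) → remove X i j ≡ true → j ≢ i × X j ≡ true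
  remove≡true⁻ X i j e with j ≟ i
  remove≡true⁻ X i j () | yes _
  ... | no j≢i = j≢i , e

  remove-keep : (X : VSet n) (i j : Fin n) → j ≢ i → remove X i j ≡ X j
  remove-keep X i j j≢i with j ≟ i
  ... | yes j≡i = contradiction j≡i j≢i
  ... | no _    = refl

  remove-remove-keep : (X : VSet n) (q i j : Fin n) → j ≢ q → remove (remove X q) i j ≡ remove X i j
  remove-remove-keep X q i j j≢q with j ≟ i
  ... | yes _ = refl
  ... | no _  = remove-keep X q j j≢q

  CoveredBy : ∀ {m} → VSet n → (Fin m → Fin n) → Set
  CoveredBy X ψ = ∀ j → X j ≡ true → ∃ λ a → ψ a ≡ j

  remove-coveredBy : ∀ {m} (X : VSet n) (ψ : Fin (suc m) → Fin n) (a : Fin (suc m)) →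
                     CoveredBy X ψ → CoveredBy (remove X (ψ a)) (ψ ∘ punchIn a)
  remove-coveredBy X ψ a cover j e with remove≡true⁻ X (ψ a) j e
  ... | j≢ψa , Xj with cover j Xj
  ...   | b , ψb≡j with a ≟ b
  ...     | yes refl = contradiction (sym ψb≡j) j≢ψa
  ...     | no a≢b   = punchOut a≢b , trans (cong ψ (punchIn-punchOut a≢b)) ψb≡j

  ∅ : VSet n
  ∅ _ = false

  zeroPath : DTree n → List (Fin n)
  zeroPath (leaf _)        = []
  zeroPath (query i t₀ _) = i ∷ zeroPath t₀

  length-zeroPath : (T : DTree n) → length (zeroPath T) ≤ depth T
  length-zeroPath (leaf _)         = z≤n
  length-zeroPath (query _ t₀ t₁) = s≤s (≤-trans (length-zeroPath t₀) (m≤m⊔n _ _))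

  eval-avoiding-zeroPath : (T : DTree n) (X : VSet n) →
                           ¬ Any (λ q → X q ≡ true) (zeroPath T) → eval T X ≡ eval T ∅
  eval-avoiding-zeroPath (leaf _) X _ = refl
  eval-avoiding-zeroPath (query i t₀ _) X avoid with X i in Xi
  ... | true  = contradiction (here Xi) avoid
  ... | false = eval-avoiding-zeroPath t₀ X (avoid ∘ there)

  fixIn : Fin n → DTree n → DTree n
  fixIn q (leaf b) = leaf b
  fixIn q (query i t₀ t₁) with i ≟ q
  ... | yes _ = fixIn q t₁
  ... | no _  = query i (fixIn q t₀) (fixIn q t₁)

  depth-fixIn : (q : Fin n) (T : DTree n) → depth (fixIn q T) ≤ depth T
  depth-fixIn q (leaf b) = z≤n
  depth-fixIn q (query i t₀ t₁) with i ≟ q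
  ... | yes _ = ≤-trans (depth-fixIn q t₁) (≤-trans (m≤n⊔m (depth t₀) _) (n≤1+n _))
  ... | no _  = s≤s (⊔-mono-≤ (depth-fixIn q t₀) (depth-fixIn q t₁))

  eval-fixIn : (q : Fin n) (T : DTree n) (Y Z : VSet n) →
               (∀ j → j ≢ q → Y j ≡ Z j) → Z q ≡ true → eval (fixIn q T) Y ≡ eval T Z
  eval-fixIn q (leaf b) Y Z _ _ = refl
  eval-fixIn q (query i t₀ t₁) Y Z agree Zq with i ≟ q
  ... | yes refl rewrite Zq = eval-fixIn q t₁ Y Z agree Zq
  ... | no i≢q rewrite agree i i≢q with Z i
  ...   | true  = eval-fixIn q t₁ Y Z agree Zq
  ...   | false = eval-fixIn q t₀ Y Z agree Zq

  record MinimalCertificate (T : DTree n) (X : VSet n) : Set where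
    field
      accepts : eval T X ≡ true
      minimal : ∀ i → X i ≡ true → eval T (remove X i) ≡ false
  open MinimalCertificate

  minimalCertificate-meets-zeroPath : ∀ {T X v} → MinimalCertificate T X → X v ≡ true →
                                      ∃ λ q → q ∈ zeroPath T × X q ≡ true
  minimalCertificate-meets-zeroPath {T} {X} {v} cert Xv
    with Any.any? (λ q → X q ≟ᵇ true) (zeroPath T)
  ... | yes hit = find hit
  ... | no avoid = contradiction accepted rejected
    where
    accepted : eval T X ≡ eval T (remove X v)
    accepted = trans (eval-avoiding-zeroPath T X avoid)
      (sym (eval-avoiding-zeroPath T (remove X v)
              (avoid ∘ Any.map (λ {q} → proj₂ ∘ remove≡true⁻ X v q))))
    rejected : eval T X ≢ eval T (remove X v)
    rejected e with () ← trans (sym (accepts cert)) (trans e (minimal cert v Xv))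

  fixIn-minimalCertificate : ∀ {T X q} → MinimalCertificate T X → X q ≡ true →
                             MinimalCertificate (fixIn q T) (remove X q)
  fixIn-minimalCertificate {T} {X} {q} cert Xq = record
    { accepts = trans (eval-fixIn q T _ X (remove-keep X q) Xq) (accepts cert)
    ; minimal = λ i e → let i≢q , Xi = remove≡true⁻ X q i e in
        trans (eval-fixIn q T _ (remove X i) (remove-remove-keep X q i)
                 (trans (remove-keep X i q (i≢q ∘ sym)) Xq))
              (minimal cert i Xi)
    }

  certificateVertices : ℕ → DTree n → List (Fin n)
  certificateVertices zero    T = []
  certificateVertices (suc m) T =
    zeroPath T ++ concatMap (λ q → certificateVertices m (fixIn q T)) (zeroPath T)

  ∈-certificateVertices : ∀ m {T X} (ψ : Fin m → Fin n) → MinimalCertificate T X →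
                          CoveredBy X ψ → ∀ {v} → X v ≡ true → v ∈ certificateVertices m T
  ∈-certificateVertices zero _ _ cover {v} Xv with () ← cover v Xv
  ∈-certificateVertices (suc m) {T} {X} ψ cert cover {v} Xv
    with minimalCertificate-meets-zeroPath cert Xv
  ... | q , q∈path , Xq with v ≟ q
  ...   | yes refl = ∈-++⁺ˡ q∈path
  ...   | no v≢q with cover q Xq
  ...     | a , refl = ∈-++⁺ʳ (zeroPath T) (∈-concatMap⁺ sub (lose q∈path v∈sub))
    where
    sub = λ q → certificateVertices m (fixIn q T)
    v∈sub : v ∈ sub (ψ a)
    v∈sub = ∈-certificateVertices m (ψ ∘ punchIn a) (fixIn-minimalCertificate cert Xq)
              (remove-coveredBy X ψ a cover) (trans (remove-keep X (ψ a) v v≢q) Xv)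

length-concatMap-≤ : ∀ {A B : Set} {b} (f : A → List B) → (∀ x → length (f x) ≤ b) →
                     (xs : List A) → length (concatMap f xs) ≤ length xs * b
length-concatMap-≤ f bound []       = z≤n
length-concatMap-≤ f bound (x ∷ xs) rewrite length-++ (f x) {concatMap f xs} =
  +-mono-≤ (bound x) (length-concatMap-≤ f bound xs)

n≤n^[1+m] : ∀ n m → n ≤ n ^ suc m
n≤n^[1+m] zero    m = z≤n
n≤n^[1+m] (suc n) m = m≤m*n (suc n) (suc n ^ m) {{m^n≢0 (suc n) m}}

length-certificateVertices : ∀ {n} m (T : DTree n) {D} → depth T ≤ D →
                             length (certificateVertices m T) ≤ m * D ^ m
length-certificateVertices zero    T _ = z≤n
length-certificateVertices (suc m) T {D} d = begin
  length (zeroPath T ++ concatMap sub (zeroPath T))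
    ≡⟨ length-++ (zeroPath T) ⟩
  length (zeroPath T) + length (concatMap sub (zeroPath T))
    ≤⟨ +-mono-≤ path≤D (length-concatMap-≤ sub
         (λ q → length-certificateVertices m (fixIn q T) (≤-trans (depth-fixIn q T) d))
         (zeroPath T)) ⟩
  D + length (zeroPath T) * (m * D ^ m)
    ≤⟨ +-mono-≤ (n≤n^[1+m] D m) (*-mono-≤ path≤D ≤-refl) ⟩
  D ^ suc m + D * (m * D ^ m)
    ≡⟨ cong (D ^ suc m +_) (x∙yz≈y∙xz D m (D ^ m)) ⟩
  suc m * D ^ suc m ∎
  where
  open ≤-Reasoning
  sub = λ q → certificateVertices m (fixIn q T)
  path≤D = ≤-trans (length-zeroPath T) d

enumeration⇒≤length : ∀ {n} (xs : List (Fin n)) → (∀ v → v ∈ xs) → n ≤ length xs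
enumeration⇒≤length xs ∈xs = injective⇒≤ {f = index ∘ ∈xs} index-injective
  where
  index-injective : ∀ {u v} → index (∈xs u) ≡ index (∈xs v) → u ≡ v
  index-injective {u} {v} e =
    trans (lookup-index (∈xs u)) (trans (cong (lookup xs) e) (sym (lookup-index (∈xs v))))

image : ∀ {k n} → (Fin k → Fin n) → VSet n
image φ j = does (any? (λ a → φ a ≟ j))

image-intro : ∀ {k n} (φ : Fin k → Fin n) a → image φ (φ a) ≡ true
image-intro φ a with any? (λ b → φ b ≟ φ a)
... | yes _ = refl
... | no ∄ = contradiction (a , refl) ∄

image-coveredBy : ∀ {k n} (φ : Fin k → Fin n) → CoveredBy (image φ) φ
image-coveredBy φ j e with any? (λ b → φ b ≟ j)
image-coveredBy φ j () | no _
... | yes ∃a = ∃a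

coveredBy-containsIn⇒≤ : ∀ {k n m} (H : Graph k) (G : Graph n) {X : VSet n} (ψ : Fin m → Fin n) →
                         CoveredBy X ψ → ContainsIn H G X → k ≤ m
coveredBy-containsIn⇒≤ H G ψ cover (φ , inj , inX , _) = injective⇒≤ {f = θ} θ-injective
  where
  θ = λ u → proj₁ (cover (φ u) (inX u))
  θ-injective : ∀ {u v} → θ u ≡ θ v → u ≡ v
  θ-injective {u} {v} e = inj (trans (sym (proj₂ (cover (φ u) (inX u))))
                                (trans (cong ψ e) (proj₂ (cover (φ v) (inX v)))))

remove-coveredBy-¬containsIn : ∀ {k n} (H : Graph k) (G : Graph n) {X : VSet n}
                               (ψ : Fin k → Fin n) (a : Fin k) →
                               CoveredBy X ψ → ¬ ContainsIn H G (remove X (ψ a))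
remove-coveredBy-¬containsIn {suc _} H G {X} ψ a cover copy =
  <-irrefl refl (coveredBy-containsIn⇒≤ H G (ψ ∘ punchIn a) (remove-coveredBy X ψ a cover) copy)

module _ {k n} (H : Graph k) (G : Graph n) where

  containsIn-mono : ∀ {X Y : VSet n} → (∀ j → X j ≡ true → Y j ≡ true) →
                    ContainsIn H G X → ContainsIn H G Y
  containsIn-mono X⊆Y (φ , inj , inX , edges) = φ , inj , (λ u → X⊆Y (φ u) (inX u)) , edges

  coveredBy-containsIn⇒minimalCertificate : ∀ {T : DTree n} {X : VSet n} (ψ : Fin k → Fin n) →
    Decides T (ContainsIn H G) → CoveredBy X ψ → ContainsIn H G X → MinimalCertificate T X
  coveredBy-containsIn⇒minimalCertificate {T} {X} ψ decides cover copy = record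
    { accepts = Equivalence.from (decides X) copy
    ; minimal = rejects
    }
    where
    rejects : ∀ i → X i ≡ true → eval T (remove X i) ≡ false
    rejects i Xi with cover i Xi | eval T (remove X i) in accepted
    ... | _ , _    | false = refl
    ... | a , refl | true  =
      contradiction (Equivalence.to (decides _) accepted) (remove-coveredBy-¬containsIn H G ψ a cover)

  relevant⇒∈copy : ∀ {v} → RelevantVertex (ContainsIn H G) v →
                   Σ (Fin k → Fin n) λ φ → ContainsIn H G (image φ) × image φ v ≡ true
  relevant⇒∈copy {v} (S , _ , inj₂ (¬PS , PS∖v)) =
    contradiction (containsIn-mono (λ j → proj₂ ∘ remove≡true⁻ S v j) PS∖v) ¬PS
  relevant⇒∈copy {v} (S , _ , inj₁ ((φ , inj , inS , edges) , ¬PS∖v))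
    with any? (λ a → φ a ≟ v)
  ... | yes (a , refl) = φ , (φ , inj , image-intro φ , edges) , image-intro φ a
  ... | no ∄ = ⊥-elim (¬PS∖v
    (φ , inj , (λ u → trans (remove-keep S v (φ u) (λ e → ∄ (u , e))) (inS u)) , edges))

theorem2 : (k : ℕ) (H : Graph k) →
    Σ ℕ λ C → Σ ℕ λ N →
    (n : ℕ) → N ≤ n → (G : Graph n) → RelevantGraph H G →
    (T : DTree n) → Decides T (ContainsIn H G) →
    n ≤ C * depth T ^ k
theorem2 k H = k , 0 , λ n _ G relevant T decides →
  ≤-trans (enumeration⇒≤length (certificateVertices k T) (λ v →
             let φ , copy , v∈image = relevant⇒∈copy H G (relevant v)
                 cover = image-coveredBy φ
             in ∈-certificateVertices k φ
                  (coveredBy-containsIn⇒minimalCertificate H G φ decides cover copy) cover v∈image))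
          (length-certificateVertices k T ≤-refl)
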